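{- Let $q=p^r$ with $p$ prime and $r\ge 1$, let $n$ be a positive integer, and let $\mathrm{Tr}(x)=\sum_{i=0}^{n-1}x^{q^i}$ be the trace map from $\mathbb{F}_{q^n}$ to $\mathbb{F}_q$, with kernel $\ker(\mathrm{Tr})=\{x\in\mathbb{F}_{q^n}:\mathrm{Tr}(x)=0\}$. Let $h(x)\in\mathbb{F}_q[x]$, let $L(x)=\sum_{i=0}^{rn-1}a_ix^{p^i}$ with all $a_i\in\mathbb{F}_q$, and let $A(x)=L(x)/x\in\mathbb{F}_q[x]$. Fix $a\in\mathbb{F}_q^*$ and assume that for every $b\in\mathbb{F}_q$ both polynomials $L(x)-\left(\frac{h(b)}{a}+A(b)\right)x$ and $L(x)-\left(\frac{h(b)+1}{a}+A(b)\right)x$ induce permutations of $\ker(\mathrm{Tr})$. Let \[H(x)=h(\mathrm{Tr}(x))+aA(\mathrm{Tr}(x))-aA(x).\] Then $x H(x)$ is a complete permutation polynomial of $\mathbb{F}_{q^n}$ if and only if $x h(x)$ is a complete permutation polynomial of $\mathbb{F}_q$.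
   Context: A polynomial $f(x)\in\mathbb{F}_Q[x]$ is a permutation polynomial of $\mathbb{F}_Q$ if the map $\alpha\mapsto f(\alpha)$ is a bijection of $\mathbb{F}_Q$. It is a complete permutation polynomial of $\mathbb{F}_Q$ if both $f(x)$ and $f(x)+x$ are permutation polynomials of $\mathbb{F}_Q$. A polynomial "induces a permutation of $\ker(\mathrm{Tr})$" if it maps $\ker(\mathrm{Tr})$ bijectively onto itself. -}

module Defs where

open import Level using (Level; _⊔_) renaming (suc to lsuc)
open import Data.Nat using (ℕ; _∸_)
open import Data.Nat as ℕ using (zero; suc) renaming (_^_ to _^ℕ_)
open import Data.Fin using (Fin; toℕ)
import Data.Fin as F
open import Data.List using (List; []; _∷_; foldr)
open import Data.Product using (Σ; ∃; _×_; _,_)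
open import Relation.Nullary using (¬_; Dec)
open import Relation.Binary.PropositionalEquality using (_≡_)
open import Algebra.Bundles using (CommutativeRing)

record FiniteField (c ℓ : Level) : Set (lsuc (c ⊔ ℓ)) where
  field
    commRing : CommutativeRing c ℓ
  open CommutativeRing commRing public
  field
    1≉0       : ¬ (1# ≈ 0#)
    _⁻¹       : Carrier → Carrier
    inverseʳ  : ∀ x → ¬ (x ≈ 0#) → (x * (x ⁻¹)) ≈ 1#
    _≟_       : ∀ x y → Dec (x ≈ y)
    size      : ℕ
    enum      : Fin size → Carrier
    enum-inj  : ∀ i j → enum i ≈ enum j → i ≡ j
    enum-surj : ∀ x → ∃ λ i → enum i ≈ x

module FieldOps {c ℓ : Level} (K : FiniteField c ℓ) where
  open FiniteField K hiding (zero)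

  infixr 8 _^_
  _^_ : Carrier → ℕ → Carrier
  x ^ zero  = 1#
  x ^ suc k = x * (x ^ k)

  sumFin : (k : ℕ) → (Fin k → Carrier) → Carrier
  sumFin zero    f = 0#
  sumFin (suc k) f = f F.zero + sumFin k (λ i → f (F.suc i))

  -- polynomial given by coefficient list c₀ ∷ c₁ ∷ …, evaluated by Horner
  evalPoly : List Carrier → Carrier → Carrier
  evalPoly cs x = foldr (λ a acc → a + (x * acc)) 0# cs

  InSub : ℕ → Carrier → Set ℓ
  InSub q x = (x ^ q) ≈ x

  Tr : (q n : ℕ) → Carrier → Carrier
  Tr q n x = sumFin n (λ i → x ^ (q ^ℕ toℕ i))

  PermutesSubset : (Carrier → Set ℓ) → (Carrier → Carrier) → Set (c ⊔ ℓ)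
  PermutesSubset S f =
    (∀ x → S x → S (f x)) ×
    (∀ x y → S x → S y → f x ≈ f y → x ≈ y) ×
    (∀ y → S y → Σ Carrier λ x → S x × (f x ≈ y))

  Permutes : (Carrier → Carrier) → Set (c ⊔ ℓ)
  Permutes f =
    (∀ x y → f x ≈ f y → x ≈ y) ×
    (∀ y → Σ Carrier λ x → f x ≈ y)

  IsCPP : (Carrier → Carrier) → Set (c ⊔ ℓ)
  IsCPP f = Permutes f × Permutes (λ x → f x + x)

  IsCPPSub : (Carrier → Set ℓ) → (Carrier → Carrier) → Set (c ⊔ ℓ)
  IsCPPSub S f = PermutesSubset S f × PermutesSubset S (λ x → f x + x)

-- Let g(t) = t h(t).  Since L has coefficients in F_q it commutes with Tr, and
-- Tr(x H(x)) = g(Tr x).  On the fibre x₀ + ker Tr over t one has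
-- x H(x) = x₀ H(x₀) - a P_t(x - x₀) with P_t(y) = L(y) - (h(t)/a + A(t)) y, which permutes ker Tr
-- by hypothesis; so x ↦ x H(x) maps each fibre bijectively onto the fibre over g(t).  As Tr maps
-- F_{q^n} onto F_q, x H(x) permutes F_{q^n} iff g permutes F_q; the same argument with h + 1
-- handles x H(x) + x.

module Submission where

open import Level using (Level)
open import Data.Empty using (⊥-elim)
open import Data.Sum using (inj₁; inj₂)
open import Data.Product using (Σ; ∃; _×_; _,_; proj₁; proj₂)
open import Data.Maybe using (Maybe; just; nothing)
open import Data.Nat as ℕ using (ℕ; zero; suc; _≥_; _∸_) renaming (_^_ to _^ℕ_; _*_ to _*ℕ_)
import Data.Nat.Properties as ℕ
open import Data.Nat.Divisibility using (_∣_; ∣1⇒≡1; ∣⇒≤; m∣m*n; quotient; m∣n⇒n≡quotient*m)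
open import Data.Nat.DivMod using (m/n*n≡m)
open import Data.Nat.Primality using (Prime; euclidsLemma; prime⇒nonZero; prime⇒nonTrivial)
open import Data.Nat.Combinatorics using (_C_; k![n∸k]!∣n!; nCn≡1)
open import Data.Nat.Combinatorics.Specification using (nCk≡n!/k![n-k]!)
open import Data.Integer as ℤ using (ℤ; +_; -[1+_]; _⊖_)
import Data.Integer.Properties as ℤ
open import Data.Sign as Sign using (Sign)
open import Data.Fin as F using (Fin; toℕ)
import Data.Fin.Properties as F
open import Data.Fin.Permutation using (Permutation; permutation; _⟨$⟩ʳ_)
open import Data.List using (List; []; _∷_)
open import Data.List.Relation.Unary.All using (All; []; _∷_)
open import Data.Vec as V using (Vec; []; _∷_)
open import Relation.Nullary using (¬_; yes; no)
open import Relation.Binary.PropositionalEquality as ≡ using (_≡_)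
import Relation.Binary.Reasoning.Setoid as SetoidReasoning
open import Function.Bundles using (_⇔_; mk⇔)
open import Function.Construct.Composition using (_⇔-∘_)
open import Data.Product.Function.NonDependent.Propositional using (_×-⇔_)
open import Algebra.Bundles using (CommutativeRing; CommutativeMonoid)
open import Algebra.Definitions using (Congruent₁)
open import Algebra.Solver.Ring.AlmostCommutativeRing using (fromCommutativeRing; _-Raw-AlmostCommutative⟶_)
import Algebra.Solver.Ring as RingSolver
import Algebra.Properties.Ring as RingProperties
import Algebra.Properties.Semiring.Mult as SemiringMult
import Algebra.Properties.Semiring.Exp as SemiringExp
import Algebra.Properties.CommutativeSemiring.Exp as CommSemiringExp
import Algebra.Properties.Monoid.Sum as MonoidSum
import Algebra.Properties.CommutativeMonoid.Sum as CommMonoidSum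
import Algebra.Properties.CommutativeSemiring.Binomial as Binomial
open import Defs

module BinomialDivisibility where
  open import Data.Nat using (_<_; _*_; _!)
  open import Data.Nat.Properties using (_!*_!≢0)

  prime∤m! : ∀ {p m} → Prime p → m < p → ¬ (p ∣ m !)
  prime∤m! {p} {zero}  p-prime _   p∣1 with ∣1⇒≡1 p∣1
  ... | ≡.refl = ℕ.nonTrivial⇒≢1 ⦃ prime⇒nonTrivial p-prime ⦄ ≡.refl
  prime∤m! {p} {suc m} p-prime m<p p∣m! with euclidsLemma (suc m) (m !) p-prime p∣m!
  ... | inj₁ p∣1+m = ℕ.<⇒≱ m<p (∣⇒≤ p∣1+m)
  ... | inj₂ p∣m!  = prime∤m! p-prime (ℕ.<-trans (ℕ.n<1+n m) m<p) p∣m!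

  prime∣C : ∀ {p k} → Prime p → 0 < k → k < p → p ∣ p C k
  prime∣C {p} {k} p-prime 0<k k<p
    with euclidsLemma (p C k) (k ! * (p ∸ k) !) p-prime p∣C*k![p∸k]!
    where
    instance _ = k !* (p ∸ k) !≢0
    p∣C*k![p∸k]! : p ∣ (p C k) * (k ! * (p ∸ k) !)
    p∣C*k![p∸k]! = ≡.subst (p ∣_) (≡.sym (≡.trans
      (≡.cong (_* (k ! * (p ∸ k) !)) (nCk≡n!/k![n-k]! (ℕ.<⇒≤ k<p)))
      (m/n*n≡m (k![n∸k]!∣n! (ℕ.<⇒≤ k<p)))))
      (p∣p! p ⦃ prime⇒nonZero p-prime ⦄)
      where
      p∣p! : ∀ n → ⦃ ℕ.NonZero n ⦄ → n ∣ n !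
      p∣p! (suc n) = m∣m*n (n !)
  ... | inj₁ p∣C = p∣C
  ... | inj₂ p∣k!*[p∸k]! with euclidsLemma (k !) ((p ∸ k) !) p-prime p∣k!*[p∸k]!
  ...   | inj₁ p∣k!     = ⊥-elim (prime∤m! p-prime k<p p∣k!)
  ...   | inj₂ p∣[p∸k]! = ⊥-elim (prime∤m! p-prime (ℕ.∸-monoʳ-< 0<k (ℕ.<⇒≤ k<p)) p∣[p∸k]!)

-- The ring solver decides equality of coefficients by computation, which the abstract
-- equality of R does not allow; so coefficients are taken from ℤ via its homomorphism into R.
module IntegerCoefficientSolver {c ℓ : Level} (R : CommutativeRing c ℓ) where
  open CommutativeRing R
  open RingProperties ring using (-0#≈0#; -‿involutive; -‿+-comm; -‿distribˡ-*; -‿distribʳ-*)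
  open SemiringMult semiring using (×-homo-+; ×1-homo-*) renaming (_×_ to _·_)
  open SetoidReasoning setoid

  signed : Sign → Carrier → Carrier
  signed Sign.+ x = x
  signed Sign.- x = - x

  signed-cong : ∀ s {x y} → x ≈ y → signed s x ≈ signed s y
  signed-cong Sign.+ x≈y = x≈y
  signed-cong Sign.- x≈y = -‿cong x≈y

  signed-* : ∀ s t x y → signed (s Sign.* t) (x * y) ≈ signed s x * signed t y
  signed-* Sign.+ Sign.+ x y = refl
  signed-* Sign.+ Sign.- x y = -‿distribʳ-* x y
  signed-* Sign.- Sign.+ x y = -‿distribˡ-* x y
  signed-* Sign.- Sign.- x y = begin
    x * y          ≈⟨ sym (-‿involutive _) ⟩
    - - (x * y)    ≈⟨ -‿cong (-‿distribˡ-* x y) ⟩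
    - (- x * y)    ≈⟨ -‿distribʳ-* (- x) y ⟩
    - x * - y      ∎

  ⟦_⟧ : ℤ → Carrier
  ⟦ i ⟧ = signed (ℤ.sign i) (ℤ.∣ i ∣ · 1#)

  ⟦◃⟧ : ∀ s n → ⟦ s ℤ.◃ n ⟧ ≈ signed s (n · 1#)
  ⟦◃⟧ Sign.+ zero    = refl
  ⟦◃⟧ Sign.- zero    = sym -0#≈0#
  ⟦◃⟧ Sign.+ (suc n) = refl
  ⟦◃⟧ Sign.- (suc n) = refl

  ⟦⊖⟧ : ∀ m n → ⟦ m ⊖ n ⟧ ≈ m · 1# - n · 1#
  ⟦⊖⟧ m       zero    = begin
    ⟦ m ⊖ 0 ⟧      ≡⟨ ≡.cong ⟦_⟧ (ℤ.⊖-≥ {m} ℕ.z≤n) ⟩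
    m · 1#         ≈⟨ sym (+-identityʳ _) ⟩
    m · 1# + 0#    ≈⟨ +-congˡ (sym -0#≈0#) ⟩
    m · 1# - 0#    ∎
  ⟦⊖⟧ zero    (suc n) = sym (+-identityˡ _)
  ⟦⊖⟧ (suc m) (suc n) = begin
    ⟦ suc m ⊖ suc n ⟧                  ≡⟨ ≡.cong ⟦_⟧ (ℤ.[1+m]⊖[1+n]≡m⊖n m n) ⟩
    ⟦ m ⊖ n ⟧                          ≈⟨ ⟦⊖⟧ m n ⟩
    m · 1# - n · 1#                    ≈⟨ sym (+-identityˡ _) ⟩
    0# + (m · 1# - n · 1#)             ≈⟨ +-congʳ (sym (-‿inverseʳ 1#)) ⟩
    (1# - 1#) + (m · 1# - n · 1#)      ≈⟨ +-assoc _ _ _ ⟩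
    1# + (- 1# + (m · 1# - n · 1#))    ≈⟨ +-congˡ (sym (+-assoc _ _ _)) ⟩
    1# + ((- 1# + m · 1#) - n · 1#)    ≈⟨ +-congˡ (+-congʳ (+-comm _ _)) ⟩
    1# + ((m · 1# - 1#) - n · 1#)      ≈⟨ +-congˡ (+-assoc _ _ _) ⟩
    1# + (m · 1# + (- 1# - n · 1#))    ≈⟨ sym (+-assoc _ _ _) ⟩
    (1# + m · 1#) + (- 1# - n · 1#)    ≈⟨ +-congˡ (-‿+-comm _ _) ⟩
    (1# + m · 1#) - (1# + n · 1#)      ∎

  ⟦⟧-+-homo : ∀ i j → ⟦ i ℤ.+ j ⟧ ≈ ⟦ i ⟧ + ⟦ j ⟧
  ⟦⟧-+-homo -[1+ m ] -[1+ n ] = begin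
    - (suc (suc (m ℕ.+ n)) · 1#)        ≡⟨ ≡.cong (λ k → - (k · 1#)) (≡.sym (ℕ.+-suc (suc m) n)) ⟩
    - ((suc m ℕ.+ suc n) · 1#)          ≈⟨ -‿cong (×-homo-+ 1# (suc m) (suc n)) ⟩
    - (suc m · 1# + suc n · 1#)         ≈⟨ sym (-‿+-comm _ _) ⟩
    - (suc m · 1#) + - (suc n · 1#)     ∎
  ⟦⟧-+-homo -[1+ m ] (+ n)    = trans (⟦⊖⟧ n (suc m)) (+-comm _ _)
  ⟦⟧-+-homo (+ m)    -[1+ n ] = ⟦⊖⟧ m (suc n)
  ⟦⟧-+-homo (+ m)    (+ n)    = ×-homo-+ 1# m n

  ⟦⟧-*-homo : ∀ i j → ⟦ i ℤ.* j ⟧ ≈ ⟦ i ⟧ * ⟦ j ⟧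
  ⟦⟧-*-homo i j = begin
    ⟦ s ℤ.◃ (ℤ.∣ i ∣ ℕ.* ℤ.∣ j ∣) ⟧                    ≈⟨ ⟦◃⟧ s (ℤ.∣ i ∣ ℕ.* ℤ.∣ j ∣) ⟩
    signed s ((ℤ.∣ i ∣ ℕ.* ℤ.∣ j ∣) · 1#)               ≈⟨ signed-cong s (×1-homo-* ℤ.∣ i ∣ ℤ.∣ j ∣) ⟩
    signed s ((ℤ.∣ i ∣ · 1#) * (ℤ.∣ j ∣ · 1#))          ≈⟨ signed-* (ℤ.sign i) (ℤ.sign j) _ _ ⟩
    ⟦ i ⟧ * ⟦ j ⟧                                       ∎
    where
    s : Sign
    s = ℤ.sign i Sign.* ℤ.sign j

  ⟦⟧-neg-homo : ∀ i → ⟦ ℤ.- i ⟧ ≈ - ⟦ i ⟧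
  ⟦⟧-neg-homo -[1+ n ]    = sym (-‿involutive _)
  ⟦⟧-neg-homo (+ zero)    = sym -0#≈0#
  ⟦⟧-neg-homo (+ suc n)   = refl

  homomorphism : ℤ.+-*-rawRing -Raw-AlmostCommutative⟶ fromCommutativeRing R
  homomorphism = record
    { ⟦_⟧ = ⟦_⟧ ; +-homo = ⟦⟧-+-homo ; *-homo = ⟦⟧-*-homo ; -‿homo = ⟦⟧-neg-homo
    ; 0-homo = refl ; 1-homo = +-identityʳ 1# }

  ⟦⟧-dec : ∀ i j → Maybe (⟦ i ⟧ ≈ ⟦ j ⟧)
  ⟦⟧-dec i j with i ℤ.≟ j
  ... | yes ≡.refl = just refl
  ... | no  _      = nothing

  open RingSolver ℤ.+-*-rawRing (fromCommutativeRing R) homomorphism ⟦⟧-dec public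
    using (solve; _:=_; _:+_; _:*_; _:-_; :-_)

module FieldBasics {c ℓ : Level} (K : FiniteField c ℓ) where
  open FiniteField K
  open FieldOps K
  open SetoidReasoning setoid
  open IntegerCoefficientSolver commRing public using (solve; _:=_; _:+_; _:*_; _:-_; :-_)
  open RingProperties ring public using (-0#≈0#; -‿involutive)
  open SemiringMult semiring public using (×1-homo-*) renaming (_×_ to _·_)
  private
    module E = SemiringExp semiring
    module CE = CommSemiringExp commutativeSemiring

  ^≡^ : ∀ x n → x ^ n ≡ x E.^ n
  ^≡^ x zero    = ≡.refl
  ^≡^ x (suc n) = ≡.cong (x *_) (^≡^ x n)

  ^-congˡ : ∀ n {x y} → x ≈ y → x ^ n ≈ y ^ n
  ^-congˡ n {x} {y} x≈y = begin
    x ^ n   ≡⟨ ^≡^ x n ⟩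
    x E.^ n ≈⟨ E.^-congˡ n x≈y ⟩
    y E.^ n ≡⟨ ≡.sym (^≡^ y n) ⟩
    y ^ n   ∎

  ^-assocʳ : ∀ x m n → (x ^ m) ^ n ≈ x ^ (m ℕ.* n)
  ^-assocʳ x m n = begin
    (x ^ m) ^ n       ≡⟨ ≡.trans (^≡^ (x ^ m) n) (≡.cong (E._^ n) (^≡^ x m)) ⟩
    (x E.^ m) E.^ n   ≈⟨ E.^-assocʳ x m n ⟩
    x E.^ (m ℕ.* n)   ≡⟨ ≡.sym (^≡^ x (m ℕ.* n)) ⟩
    x ^ (m ℕ.* n)     ∎

  ^-comm : ∀ x m n → (x ^ m) ^ n ≈ (x ^ n) ^ m
  ^-comm x m n = begin
    (x ^ m) ^ n    ≈⟨ ^-assocʳ x m n ⟩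
    x ^ (m ℕ.* n)  ≡⟨ ≡.cong (x ^_) (ℕ.*-comm m n) ⟩
    x ^ (n ℕ.* m)  ≈⟨ sym (^-assocʳ x n m) ⟩
    (x ^ n) ^ m    ∎

  ^-distrib-* : ∀ x y n → (x * y) ^ n ≈ x ^ n * y ^ n
  ^-distrib-* x y n = begin
    (x * y) ^ n        ≡⟨ ^≡^ (x * y) n ⟩
    (x * y) E.^ n      ≈⟨ CE.^-distrib-* x y n ⟩
    x E.^ n * y E.^ n  ≡⟨ ≡.sym (≡.cong₂ _*_ (^≡^ x n) (^≡^ y n)) ⟩
    x ^ n * y ^ n      ∎

  1^n≈1 : ∀ n → 1# ^ n ≈ 1#
  1^n≈1 zero    = refl
  1^n≈1 (suc n) = trans (*-identityˡ _) (1^n≈1 n)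

  x^n≈x*x^[n∸1] : ∀ x n → ⦃ ℕ.NonZero n ⦄ → x ^ n ≈ x * x ^ (n ℕ.∸ 1)
  x^n≈x*x^[n∸1] x (suc n) = refl

  evalPoly-cong : ∀ cs → Congruent₁ _≈_ (evalPoly cs)
  evalPoly-cong []       x≈y = refl
  evalPoly-cong (a ∷ cs) x≈y = +-congˡ (*-cong x≈y (evalPoly-cong cs x≈y))

  sumFin-cong : ∀ k {f g : Fin k → Carrier} → (∀ i → f i ≈ g i) → sumFin k f ≈ sumFin k g
  sumFin-cong zero    f≈g = refl
  sumFin-cong (suc k) f≈g = +-cong (f≈g F.zero) (sumFin-cong k (λ i → f≈g (F.suc i)))

  sumFin-distrib-+ : ∀ k (f g : Fin k → Carrier) →
                     sumFin k (λ i → f i + g i) ≈ sumFin k f + sumFin k g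
  sumFin-distrib-+ zero    f g = sym (+-identityˡ 0#)
  sumFin-distrib-+ (suc k) f g = trans (+-congˡ (sumFin-distrib-+ k _ _))
    (solve 4 (λ a b c d → (a :+ b) :+ (c :+ d) := (a :+ c) :+ (b :+ d)) refl _ _ _ _)

  *-distribˡ-sumFin : ∀ k x (f : Fin k → Carrier) → x * sumFin k f ≈ sumFin k (λ i → x * f i)
  *-distribˡ-sumFin zero    x f = zeroʳ x
  *-distribˡ-sumFin (suc k) x f = trans (distribˡ x _ _) (+-congˡ (*-distribˡ-sumFin k x _))

  sumFin-zero : ∀ k → sumFin k (λ _ → 0#) ≈ 0#
  sumFin-zero zero    = refl
  sumFin-zero (suc k) = trans (+-identityˡ _) (sumFin-zero k)

  sumFin-comm : ∀ k m (f : Fin k → Fin m → Carrier) →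
    sumFin k (λ i → sumFin m (f i)) ≈ sumFin m (λ j → sumFin k (λ i → f i j))
  sumFin-comm zero    m f = sym (sumFin-zero m)
  sumFin-comm (suc k) m f = begin
    sumFin m (f F.zero) + sumFin k (λ i → sumFin m (f (F.suc i)))            ≈⟨ +-congˡ (sumFin-comm k m _) ⟩
    sumFin m (f F.zero) + sumFin m (λ j → sumFin k (λ i → f (F.suc i) j))    ≈⟨ sym (sumFin-distrib-+ m _ _) ⟩
    sumFin m (λ j → sumFin (suc k) (λ i → f i j))                           ∎

  sumFin-last : ∀ m (f : ℕ → Carrier) → sumFin (suc m) (λ i → f (toℕ i)) ≈ sumFin m (λ i → f (toℕ i)) + f m
  sumFin-last zero    f = trans (+-identityʳ _) (sym (+-identityˡ _))
  sumFin-last (suc m) f = trans (+-congˡ (sumFin-last m (λ k → f (suc k)))) (sym (+-assoc _ _ _))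

  sumFin-rotate : ∀ m (f : ℕ → Carrier) → f m ≈ f 0 →
    sumFin m (λ i → f (suc (toℕ i))) ≈ sumFin m (λ i → f (toℕ i))
  sumFin-rotate zero     f _        = refl
  sumFin-rotate (suc m) f fm≈f0 = begin
    sumFin (suc m) (λ i → f (suc (toℕ i)))    ≈⟨ sumFin-last m (λ k → f (suc k)) ⟩
    sumFin m (λ i → f (suc (toℕ i))) + f (suc m) ≈⟨ +-comm _ _ ⟩
    f (suc m) + sumFin m (λ i → f (suc (toℕ i))) ≈⟨ +-congʳ fm≈f0 ⟩
    sumFin (suc m) (λ i → f (toℕ i))          ∎

  x*y≈0⇒y≈0 : ∀ {x y} → ¬ (x ≈ 0#) → x * y ≈ 0# → y ≈ 0#
  x*y≈0⇒y≈0 {x} {y} x≉0 xy≈0 = begin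
    y                ≈⟨ sym (*-identityˡ y) ⟩
    1# * y           ≈⟨ *-congʳ (sym (trans (*-comm _ _) (inverseʳ x x≉0))) ⟩
    (x ⁻¹ * x) * y   ≈⟨ *-assoc _ _ _ ⟩
    x ⁻¹ * (x * y)   ≈⟨ *-congˡ xy≈0 ⟩
    x ⁻¹ * 0#        ≈⟨ zeroʳ _ ⟩
    0#               ∎

  *-nonzero : ∀ {x y} → ¬ (x ≈ 0#) → ¬ (y ≈ 0#) → ¬ (x * y ≈ 0#)
  *-nonzero x≉0 y≉0 xy≈0 = y≉0 (x*y≈0⇒y≈0 x≉0 xy≈0)

  x^n≈0⇒x≈0 : ∀ {x} n → x ^ n ≈ 0# → x ≈ 0#
  x^n≈0⇒x≈0     zero    1≈0 = ⊥-elim (1≉0 1≈0)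
  x^n≈0⇒x≈0 {x} (suc n) xxⁿ≈0 with x ≟ 0#
  ... | yes x≈0 = x≈0
  ... | no  x≉0 = x^n≈0⇒x≈0 n (x*y≈0⇒y≈0 x≉0 xxⁿ≈0)

  x-y≈0⇒x≈y : ∀ {x y} → x - y ≈ 0# → x ≈ y
  x-y≈0⇒x≈y {x} {y} x-y≈0 = begin
    x             ≈⟨ solve 2 (λ x y → x := (x :- y) :+ y) refl x y ⟩
    (x - y) + y   ≈⟨ +-congʳ x-y≈0 ⟩
    0# + y        ≈⟨ +-identityˡ y ⟩
    y             ∎

  *-cancelˡ : ∀ {a x y} → ¬ (a ≈ 0#) → a * x ≈ a * y → x ≈ y
  *-cancelˡ {a} {x} {y} a≉0 ax≈ay = x-y≈0⇒x≈y (x*y≈0⇒y≈0 a≉0 (begin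
    a * (x - y)    ≈⟨ solve 3 (λ a x y → a :* (x :- y) := a :* x :- a :* y) refl a x y ⟩
    a * x - a * y  ≈⟨ +-congʳ ax≈ay ⟩
    a * y - a * y  ≈⟨ -‿inverseʳ _ ⟩
    0#             ∎))

module Counting {c ℓ : Level} (K : FiniteField c ℓ) where
  open FiniteField K
  open FieldOps K
  open FieldBasics K
  open SetoidReasoning setoid
  private
    module Σ+ = CommMonoidSum +-commutativeMonoid
    module Π = CommMonoidSum *-commutativeMonoid

  module _ (φ ψ : Carrier → Carrier) (φ-cong : Congruent₁ _≈_ φ) (ψ-cong : Congruent₁ _≈_ ψ)
           (φ∘ψ : ∀ x → φ (ψ x) ≈ x) (ψ∘φ : ∀ x → ψ (φ x) ≈ x) where

    enumPermutation : Permutation size size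
    enumPermutation = permutation (along φ) (along ψ)
      (λ i → enum-inj _ _ (trans (along-spec φ (along ψ i)) (trans (φ-cong (along-spec ψ i)) (φ∘ψ (enum i)))))
      (λ i → enum-inj _ _ (trans (along-spec ψ (along φ i)) (trans (ψ-cong (along-spec φ i)) (ψ∘φ (enum i)))))
      where
      along : (Carrier → Carrier) → Fin size → Fin size
      along χ i = proj₁ (enum-surj (χ (enum i)))
      along-spec : ∀ χ i → enum (along χ i) ≈ χ (enum i)
      along-spec χ i = proj₂ (enum-surj (χ (enum i)))

    sum-enum-∘ : ∀ {a b} (M : CommutativeMonoid a b) (f : Carrier → CommutativeMonoid.Carrier M) →
                 (∀ {x y} → x ≈ y → CommutativeMonoid._≈_ M (f x) (f y)) →
                 CommutativeMonoid._≈_ M (CommMonoidSum.sum M (λ i → f (φ (enum i)))) (CommMonoidSum.sum M (λ i → f (enum i)))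
    sum-enum-∘ M f f-cong = M.sym (M.trans (ΣM.sum-permute (λ i → f (enum i)) enumPermutation)
                                           (ΣM.sum-cong-≋ (λ i → f-cong (enum-to i))))
      where
      module M = CommutativeMonoid M
      module ΣM = CommMonoidSum M
      enum-to : ∀ i → enum (enumPermutation ⟨$⟩ʳ i) ≈ φ (enum i)
      enum-to i = proj₂ (enum-surj (φ (enum i)))

  -- Translation by 1 permutes K, so it fixes ∑ x; comparing the two sums gives size · 1 ≈ 0.
  size·1≈0 : size · 1# ≈ 0#
  size·1≈0 = begin
    size · 1#                                ≈⟨ sym (Σ+.sum-replicate size) ⟩
    Σ+.sum {size} (λ _ → 1#)                 ≈⟨ solve 2 (λ S n → n := (S :+ n) :- S) refl S _ ⟩
    (S + Σ+.sum {size} (λ _ → 1#)) - S       ≈⟨ +-congʳ (sym (Σ+.∑-distrib-+ enum (λ _ → 1#))) ⟩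
    Σ+.sum (λ i → enum i + 1#) - S           ≈⟨ +-congʳ translation-invariant ⟩
    S - S                                    ≈⟨ -‿inverseʳ S ⟩
    0#                                       ∎
    where
    S : Carrier
    S = Σ+.sum enum
    translation-invariant : Σ+.sum (λ i → enum i + 1#) ≈ S
    translation-invariant = sum-enum-∘ (_+ 1#) (_- 1#) +-congʳ +-congʳ
      (λ x → solve 2 (λ x o → x :- o :+ o := x) refl x 1#)
      (λ x → solve 2 (λ x o → x :+ o :- o := x) refl x 1#)
      +-commutativeMonoid (λ x → x) (λ x≈y → x≈y)

  ^·1 : ∀ m k → (m ℕ.^ k) · 1# ≈ (m · 1#) ^ k
  ^·1 m zero    = +-identityʳ 1#
  ^·1 m (suc k) = trans (×1-homo-* m (m ℕ.^ k)) (*-congˡ (^·1 m k))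

  characteristic : ∀ p m → size ≡ p ℕ.^ m → p · 1# ≈ 0#
  characteristic p m size≡pᵐ = x^n≈0⇒x≈0 m (begin
    (p · 1#) ^ m     ≈⟨ sym (^·1 p m) ⟩
    (p ℕ.^ m) · 1#   ≡⟨ ≡.cong (_· 1#) (≡.sym size≡pᵐ) ⟩
    size · 1#        ≈⟨ size·1≈0 ⟩
    0#               ∎)

  nonzeroOr1 : Carrier → Carrier
  nonzeroOr1 x with x ≟ 0#
  ... | yes _ = 1#
  ... | no  _ = x

  nonzeroOr1-cong : Congruent₁ _≈_ nonzeroOr1
  nonzeroOr1-cong {x} {y} x≈y with x ≟ 0# | y ≟ 0#
  ... | yes _   | yes _   = refl
  ... | yes x≈0 | no  y≉0 = ⊥-elim (y≉0 (trans (sym x≈y) x≈0))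
  ... | no  x≉0 | yes y≈0 = ⊥-elim (x≉0 (trans x≈y y≈0))
  ... | no  _   | no  _   = x≈y

  nonzeroOr1-zero : ∀ {x} → x ≈ 0# → nonzeroOr1 x ≈ 1#
  nonzeroOr1-zero {x} x≈0 with x ≟ 0#
  ... | yes _   = refl
  ... | no  x≉0 = ⊥-elim (x≉0 x≈0)

  nonzeroOr1-nonzero : ∀ {x} → ¬ (x ≈ 0#) → nonzeroOr1 x ≈ x
  nonzeroOr1-nonzero {x} x≉0 with x ≟ 0#
  ... | yes x≈0 = ⊥-elim (x≉0 x≈0)
  ... | no  _   = refl

  ∏-scale : ∀ k a (u : Fin k → Carrier) → Π.sum (λ j → a * u j) ≈ a ^ k * Π.sum u
  ∏-scale zero    a u = sym (*-identityˡ 1#)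
  ∏-scale (suc k) a u = trans (*-congˡ (∏-scale k a (λ j → u (F.suc j))))
    (solve 4 (λ a u b c → a :* u :* (b :* c) := a :* b :* (u :* c)) refl a (u F.zero) (a ^ k) _)

  ∏-nonzero : ∀ k (u : Fin k → Carrier) → (∀ j → ¬ (u j ≈ 0#)) → ¬ (Π.sum u ≈ 0#)
  ∏-nonzero zero    u u≉0 = 1≉0
  ∏-nonzero (suc k) u u≉0 = *-nonzero (u≉0 F.zero) (∏-nonzero k (λ j → u (F.suc j)) (λ j → u≉0 (F.suc j)))

  -- Products of nonzeroOr1 range over the nonzero elements, which multiplication by a ≉ 0
  -- permutes; their product U is nonzero and aᴺ U ≈ U, where N + 1 = size.
  a^[size∸1]≈1 : ∀ {a} → ¬ (a ≈ 0#) → a ^ (size ℕ.∸ 1) ≈ 1#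
  a^[size∸1]≈1 {a} a≉0 = aᴺ≈1 size enum enum-inj (proj₁ (enum-surj 0#)) (proj₂ (enum-surj 0#))
    (sum-enum-∘ (a *_) ((a ⁻¹) *_) *-congˡ *-congˡ (cancel (a ⁻¹) a aa⁻¹≈1) (cancel a (a ⁻¹) a⁻¹a≈1)
      *-commutativeMonoid nonzeroOr1 nonzeroOr1-cong)
    where
    aa⁻¹≈1 : a * a ⁻¹ ≈ 1#
    aa⁻¹≈1 = inverseʳ a a≉0
    a⁻¹a≈1 : a ⁻¹ * a ≈ 1#
    a⁻¹a≈1 = trans (*-comm _ _) aa⁻¹≈1
    cancel : ∀ b c → c * b ≈ 1# → ∀ x → c * (b * x) ≈ x
    cancel b c cb≈1 x = trans (sym (*-assoc c b x)) (trans (*-congʳ cb≈1) (*-identityˡ x))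
    aᴺ≈1 : ∀ n (e : Fin n → Carrier) → (∀ i j → e i ≈ e j → i ≡ j) → ∀ z → e z ≈ 0# →
         Π.sum (λ i → nonzeroOr1 (a * e i)) ≈ Π.sum (λ i → nonzeroOr1 (e i)) → a ^ (n ℕ.∸ 1) ≈ 1#
    aᴺ≈1 (suc N) e e-inj z ez≈0 invariant = *-cancelˡ (∏-nonzero N u u≉0) (begin
      U * a ^ N                                       ≈⟨ *-comm _ _ ⟩
      a ^ N * U                                       ≈⟨ sym (∏-scale N a u) ⟩
      Π.sum (λ j → a * u j)                           ≈⟨ Π.sum-cong-≋ (λ j → sym (nonzeroOr1-nonzero (*-nonzero a≉0 (u≉0 j)))) ⟩
      Π.sum (λ j → nonzeroOr1 (a * u j))              ≈⟨ sym (*-identityˡ _) ⟩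
      1# * Π.sum (λ j → nonzeroOr1 (a * u j))         ≈⟨ *-congʳ (sym (nonzeroOr1-zero (trans (*-congˡ ez≈0) (zeroʳ a)))) ⟩
      nonzeroOr1 (a * e z) * Π.sum (λ j → nonzeroOr1 (a * u j)) ≈⟨ sym (Π.sum-remove {i = z} (λ i → nonzeroOr1 (a * e i))) ⟩
      Π.sum (λ i → nonzeroOr1 (a * e i))              ≈⟨ invariant ⟩
      Π.sum (λ i → nonzeroOr1 (e i))                  ≈⟨ Π.sum-remove {i = z} (λ i → nonzeroOr1 (e i)) ⟩
      nonzeroOr1 (e z) * Π.sum (λ j → nonzeroOr1 (u j))
        ≈⟨ *-cong (nonzeroOr1-zero ez≈0) (Π.sum-cong-≋ (λ j → nonzeroOr1-nonzero (u≉0 j))) ⟩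
      1# * U                                          ≈⟨ *-comm _ _ ⟩
      U * 1#                                          ∎)
      where
      u : Fin N → Carrier
      u j = e (F.punchIn z j)
      u≉0 : ∀ j → ¬ (u j ≈ 0#)
      u≉0 j u≈0 = F.punchInᵢ≢i z j (e-inj _ _ (trans u≈0 (sym ez≈0)))
      U : Carrier
      U = Π.sum u

  size≡1+size∸1 : size ≡ suc (size ℕ.∸ 1)
  size≡1+size∸1 = ≡.sym (ℕ.suc-pred size ⦃ F.nonZeroIndex (proj₁ (enum-surj 0#)) ⦄)

  x^size≈x : ∀ x → x ^ size ≈ x
  x^size≈x x with x ≟ 0#
  ... | yes x≈0 = begin
    x ^ size                  ≈⟨ ^-congˡ size x≈0 ⟩
    0# ^ size                 ≡⟨ ≡.cong (0# ^_) size≡1+size∸1 ⟩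
    0# * 0# ^ (size ℕ.∸ 1)    ≈⟨ zeroˡ _ ⟩
    0#                        ≈⟨ sym x≈0 ⟩
    x                         ∎
  ... | no  x≉0 = begin
    x ^ size                  ≡⟨ ≡.cong (x ^_) size≡1+size∸1 ⟩
    x * x ^ (size ℕ.∸ 1)      ≈⟨ *-congˡ (a^[size∸1]≈1 x≉0) ⟩
    x * 1#                    ≈⟨ *-identityʳ x ⟩
    x                         ∎

module CharacteristicP {c ℓ : Level} (K : FiniteField c ℓ) where
  open FiniteField K
  open FieldOps K
  open FieldBasics K
  open SemiringMult semiring using (×-assoc-*; ×-congʳ)
  open BinomialDivisibility
  open SetoidReasoning setoid
  private
    module E = SemiringExp semiring
    module Σ+ = MonoidSum +-monoid
    module Bin = Binomial commutativeSemiring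

  ·≈·1* : ∀ n z → n · z ≈ (n · 1#) * z
  ·≈·1* n z = sym (trans (×-assoc-* n 1# z) (×-congʳ n (*-identityˡ z)))

  ∣⇒·≈0 : ∀ {p n} → p · 1# ≈ 0# → p ∣ n → ∀ z → n · z ≈ 0#
  ∣⇒·≈0 {p} {n} p·1≈0 p∣n z = begin
    n · z                                  ≡⟨ ≡.cong (_· z) (m∣n⇒n≡quotient*m p∣n) ⟩
    (quotient p∣n ℕ.* p) · z               ≈⟨ ·≈·1* (quotient p∣n ℕ.* p) z ⟩
    ((quotient p∣n ℕ.* p) · 1#) * z        ≈⟨ *-congʳ (×1-homo-* (quotient p∣n) p) ⟩
    ((quotient p∣n · 1#) * (p · 1#)) * z   ≈⟨ *-congʳ (*-congˡ p·1≈0) ⟩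
    ((quotient p∣n · 1#) * 0#) * z         ≈⟨ *-congʳ (zeroʳ _) ⟩
    0# * z                                 ≈⟨ zeroˡ z ⟩
    0#                                     ∎

  frobenius : ∀ {p} → Prime p → p · 1# ≈ 0# → ∀ x y → (x + y) ^ p ≈ x ^ p + y ^ p
  frobenius {zero}  p-prime = ⊥-elim (ℕ.NonZero.nonZero (prime⇒nonZero p-prime))
  frobenius {suc q} p-prime p·1≈0 x y = begin
    (x + y) ^ p                                              ≡⟨ ^≡^ (x + y) p ⟩
    (x + y) E.^ p                                            ≈⟨ Bin.theorem p x y ⟩
    term F.zero + Σ+.sum (λ i → term (F.suc i))              ≈⟨ +-congˡ (Σ+.sum-init-last (λ i → term (F.suc i))) ⟩
    term F.zero + (Σ+.sum (λ i → term (F.suc (F.inject₁ i))) + term (F.suc (F.fromℕ q)))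
      ≈⟨ +-cong term-bottom (+-cong middle (term-top (F.suc (F.fromℕ q)) (≡.cong suc (F.toℕ-fromℕ q)))) ⟩
    y ^ p + (0# + x ^ p)                                     ≈⟨ trans (+-congˡ (+-identityˡ _)) (+-comm _ _) ⟩
    x ^ p + y ^ p                                            ∎
    where
    p : ℕ
    p = suc q
    term : Fin (suc p) → Carrier
    term = Bin.binomialTerm x y p
    term-bottom : term F.zero ≈ y ^ p
    term-bottom = begin
      1# * y E.^ p + 0#   ≈⟨ trans (+-identityʳ _) (*-identityˡ _) ⟩
      y E.^ p             ≡⟨ ≡.sym (^≡^ y p) ⟩
      y ^ p               ∎
    term-top : ∀ i → toℕ i ≡ p → term i ≈ x ^ p
    term-top i i≡p = begin
      (p C toℕ i) · (x E.^ toℕ i * y E.^ (p ℕ.∸ toℕ i))  ≡⟨ ≡.cong (λ k → (p C k) · (x E.^ k * y E.^ (p ℕ.∸ k))) i≡p ⟩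
      (p C p) · (x E.^ p * y E.^ (p ℕ.∸ p))   ≡⟨ ≡.cong₂ _·_ (nCn≡1 p) (≡.cong (λ m → x E.^ p * y E.^ m) (ℕ.n∸n≡0 p)) ⟩
      1 · (x E.^ p * 1#)                      ≈⟨ trans (+-identityʳ _) (*-identityʳ _) ⟩
      x E.^ p                                 ≡⟨ ≡.sym (^≡^ x p) ⟩
      x ^ p                                   ∎
    middle : Σ+.sum (λ i → term (F.suc (F.inject₁ i))) ≈ 0#
    middle = trans (Σ+.sum-cong-≋ (λ i → ∣⇒·≈0 p·1≈0 (prime∣C p-prime (ℕ.s≤s ℕ.z≤n)
                     (ℕ.s≤s (≡.subst (ℕ._< q) (≡.sym (F.toℕ-inject₁ i)) (F.toℕ<n i)))) _))
                   (Σ+.sum-replicate-zero q)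

module MonicPolynomial {c ℓ : Level} (K : FiniteField c ℓ) where
  open FiniteField K
  open FieldOps K
  open FieldBasics K
  open SetoidReasoning setoid

  evalMonic : ∀ {d} → Vec Carrier d → Carrier → Carrier
  evalMonic {d} cs x = evalPoly (V.toList cs) x + x ^ d

  evalMonic-∷ : ∀ {d} a (cs : Vec Carrier d) x → evalMonic (a ∷ cs) x ≈ a + x * evalMonic cs x
  evalMonic-∷ {d} a cs x =
    solve 4 (λ a x v w → (a :+ x :* v) :+ x :* w := a :+ x :* (v :+ w)) refl a x (evalPoly (V.toList cs) x) (x ^ d)

  divideByLinear : ∀ {d} → Carrier → Vec Carrier (suc d) → Vec Carrier d × Carrier
  divideByLinear r (a ∷ [])           = [] , a + r
  divideByLinear r (a ∷ cs@(_ ∷ _)) with divideByLinear r cs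
  ... | qs , s = (s ∷ qs) , a + r * s

  divideByLinear-spec : ∀ {d} r (cs : Vec Carrier (suc d)) x →
    evalMonic cs x ≈ (x - r) * evalMonic (proj₁ (divideByLinear r cs)) x + proj₂ (divideByLinear r cs)
  divideByLinear-spec r (a ∷ []) x = begin
    (a + x * 0#) + x * 1#         ≈⟨ +-cong (trans (+-congˡ (zeroʳ x)) (+-identityʳ a)) (*-identityʳ x) ⟩
    a + x                         ≈⟨ solve 3 (λ a x r → a :+ x := (x :- r) :+ (a :+ r)) refl a x r ⟩
    (x - r) + (a + r)             ≈⟨ +-congʳ (sym (trans (*-congˡ (+-identityˡ 1#)) (*-identityʳ _))) ⟩
    (x - r) * (0# + 1#) + (a + r) ∎
  divideByLinear-spec r (a ∷ cs@(_ ∷ _)) x with divideByLinear r cs | divideByLinear-spec r cs x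
  ... | qs , s | cs≈ = begin
    evalMonic (a ∷ cs) x                   ≈⟨ evalMonic-∷ a cs x ⟩
    a + x * evalMonic cs x                 ≈⟨ +-congˡ (*-congˡ cs≈) ⟩
    a + x * ((x - r) * M + s)              ≈⟨ solve 5 (λ a x r M s → a :+ x :* ((x :- r) :* M :+ s) :=
                                                (x :- r) :* (s :+ x :* M) :+ (a :+ r :* s)) refl a x r M s ⟩
    (x - r) * (s + x * M) + (a + r * s)    ≈⟨ +-congʳ (*-congˡ (sym (evalMonic-∷ s qs x))) ⟩
    (x - r) * evalMonic (s ∷ qs) x + (a + r * s) ∎
    where
    M : Carrier
    M = evalMonic qs x

  monic-roots : ∀ d (cs : Vec Carrier d) (pts : Fin (suc d) → Carrier) →
    (∀ i j → pts i ≈ pts j → i ≡ j) → ¬ (∀ i → evalMonic cs (pts i) ≈ 0#)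
  monic-roots zero    []  pts pts-inj roots = 1≉0 (trans (sym (+-identityˡ 1#)) (roots F.zero))
  monic-roots (suc d) cs pts pts-inj roots =
    monic-roots d qs (λ i → pts (F.suc i)) (λ i j eq → F.suc-injective (pts-inj _ _ eq)) qs-roots
    where
    r : Carrier
    r = pts F.zero
    qs : Vec Carrier d
    qs = proj₁ (divideByLinear r cs)
    s : Carrier
    s = proj₂ (divideByLinear r cs)
    s≈0 : s ≈ 0#
    s≈0 = begin
      s                           ≈⟨ solve 3 (λ r M s → s := (r :- r) :* M :+ s) refl r (evalMonic qs r) s ⟩
      (r - r) * evalMonic qs r + s ≈⟨ sym (divideByLinear-spec r cs r) ⟩
      evalMonic cs r              ≈⟨ roots F.zero ⟩
      0#                          ∎
    qs-roots : ∀ i → evalMonic qs (pts (F.suc i)) ≈ 0#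
    qs-roots i = x*y≈0⇒y≈0 (λ x-r≈0 → F.0≢1+n (≡.sym (pts-inj _ _ (x-y≈0⇒x≈y x-r≈0)))) (begin
      (x - r) * evalMonic qs x        ≈⟨ sym (+-identityʳ _) ⟩
      (x - r) * evalMonic qs x + 0#   ≈⟨ +-congˡ (sym s≈0) ⟩
      (x - r) * evalMonic qs x + s    ≈⟨ sym (divideByLinear-spec r cs x) ⟩
      evalMonic cs x                  ≈⟨ roots (F.suc i) ⟩
      0#                              ∎)
      where
      x : Carrier
      x = pts (F.suc i)

  evalPoly-tabulate : ∀ D (g : Fin D → Carrier) x →
    evalPoly (V.toList (V.tabulate g)) x ≈ sumFin D (λ j → g j * x ^ toℕ j)
  evalPoly-tabulate zero    g x = refl
  evalPoly-tabulate (suc D) g x = begin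
    g F.zero + x * evalPoly (V.toList (V.tabulate (λ j → g (F.suc j)))) x
      ≈⟨ +-cong (sym (*-identityʳ _)) (*-congˡ (evalPoly-tabulate D _ x)) ⟩
    g F.zero * 1# + x * sumFin D (λ j → g (F.suc j) * x ^ toℕ j)
      ≈⟨ +-congˡ (*-distribˡ-sumFin D x _) ⟩
    g F.zero * 1# + sumFin D (λ j → x * (g (F.suc j) * x ^ toℕ j))
      ≈⟨ +-congˡ (sumFin-cong D (λ j → solve 3 (λ x g y → x :* (g :* y) := g :* (x :* y)) refl x _ _)) ⟩
    g F.zero * 1# + sumFin D (λ j → g (F.suc j) * (x * x ^ toℕ j)) ∎

  δ : ℕ → ℕ → Carrier
  δ zero    zero    = 1#
  δ zero    (suc _) = 0#
  δ (suc _) zero    = 0#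
  δ (suc m) (suc n) = δ m n

  ∑δ* : ∀ D e → e ℕ.< D → (f : ℕ → Carrier) → sumFin D (λ j → δ (toℕ j) e * f (toℕ j)) ≈ f e
  ∑δ* (suc D) zero    _ f = begin
    1# * f 0 + sumFin D (λ j → 0# * f (suc (toℕ j)))  ≈⟨ +-cong (*-identityˡ _) (sumFin-cong D (λ j → zeroˡ _)) ⟩
    f 0 + sumFin D (λ j → 0#)                         ≈⟨ +-congˡ (sumFin-zero D) ⟩
    f 0 + 0#                                          ≈⟨ +-identityʳ _ ⟩
    f 0                                               ∎
  ∑δ* (suc D) (suc e) (ℕ.s≤s e<D) f = begin
    0# * f 0 + sumFin D (λ j → δ (toℕ j) e * f (suc (toℕ j)))  ≈⟨ +-cong (zeroˡ _) (∑δ* D e e<D (λ k → f (suc k))) ⟩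
    0# + f (suc e)                                            ≈⟨ +-identityˡ _ ⟩
    f (suc e)                                                 ∎

  ∑-powers-polynomial : ∀ k (E : Fin k → ℕ) D → (∀ i → E i ℕ.< D) →
    Σ (Vec Carrier D) λ cs → ∀ x → evalPoly (V.toList cs) x ≈ sumFin k (λ i → x ^ E i)
  ∑-powers-polynomial k E D E<D = V.tabulate coeff , λ x → begin
    evalPoly (V.toList (V.tabulate coeff)) x                     ≈⟨ evalPoly-tabulate D coeff x ⟩
    sumFin D (λ j → coeff j * x ^ toℕ j)                          ≈⟨ sumFin-cong D (λ j → *-comm _ _) ⟩
    sumFin D (λ j → x ^ toℕ j * coeff j)                          ≈⟨ sumFin-cong D (λ j → *-distribˡ-sumFin k _ _) ⟩
    sumFin D (λ j → sumFin k (λ i → x ^ toℕ j * δ (toℕ j) (E i))) ≈⟨ sumFin-comm D k _ ⟩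
    sumFin k (λ i → sumFin D (λ j → x ^ toℕ j * δ (toℕ j) (E i)))
      ≈⟨ sumFin-cong k (λ i → trans (sumFin-cong D (λ j → *-comm _ _)) (∑δ* D (E i) (E<D i) (x ^_))) ⟩
    sumFin k (λ i → x ^ E i)                                      ∎
    where
    coeff : Fin D → Carrier
    coeff j = sumFin k (λ i → δ (toℕ j) (E i))

module AdditiveMaps {c ℓ : Level} (K : FiniteField c ℓ) where
  open FiniteField K
  open FieldOps K
  open FieldBasics K
  open SetoidReasoning setoid

  record IsAdditive (φ : Carrier → Carrier) : Set (c Level.⊔ ℓ) where
    field
      cong : Congruent₁ _≈_ φ
      homo : ∀ x y → φ (x + y) ≈ φ x + φ y

    0-homo : φ 0# ≈ 0#
    0-homo = begin
      φ 0#                     ≈⟨ solve 2 (λ u v → u := (u :+ v) :- v) refl (φ 0#) (φ 0#) ⟩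
      (φ 0# + φ 0#) - φ 0#     ≈⟨ +-congʳ (sym (homo 0# 0#)) ⟩
      φ (0# + 0#) - φ 0#       ≈⟨ +-congʳ (cong (+-identityʳ 0#)) ⟩
      φ 0# - φ 0#              ≈⟨ -‿inverseʳ _ ⟩
      0#                       ∎

    -‿homo : ∀ x → φ (- x) ≈ - φ x
    -‿homo x = begin
      φ (- x)                  ≈⟨ solve 2 (λ u v → u := (u :+ v) :- v) refl (φ (- x)) (φ x) ⟩
      (φ (- x) + φ x) - φ x    ≈⟨ +-congʳ (sym (homo (- x) x)) ⟩
      φ (- x + x) - φ x        ≈⟨ +-congʳ (trans (cong (-‿inverseˡ x)) 0-homo) ⟩
      0# - φ x                 ≈⟨ +-identityˡ _ ⟩
      - φ x                    ∎

    sub-homo : ∀ x y → φ (x - y) ≈ φ x - φ y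
    sub-homo x y = trans (homo x (- y)) (+-congˡ (-‿homo y))

    sumFin-homo : ∀ k (f : Fin k → Carrier) → φ (sumFin k f) ≈ sumFin k (λ i → φ (f i))
    sumFin-homo zero    f = 0-homo
    sumFin-homo (suc k) f = trans (homo _ _) (+-congˡ (sumFin-homo k (λ i → f (F.suc i))))

  open IsAdditive public

  scale-isAdditive : ∀ a {φ} → IsAdditive φ → IsAdditive (λ x → a * φ x)
  scale-isAdditive a φ-additive = record
    { cong = λ x≈y → *-congˡ (cong φ-additive x≈y)
    ; homo = λ x y → trans (*-congˡ (homo φ-additive x y)) (distribˡ a _ _) }

  sumFin-isAdditive : ∀ k {φ : Fin k → Carrier → Carrier} → (∀ i → IsAdditive (φ i)) →
                      IsAdditive (λ x → sumFin k (λ i → φ i x))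
  sumFin-isAdditive k φ-additive = record
    { cong = λ x≈y → sumFin-cong k (λ i → cong (φ-additive i) x≈y)
    ; homo = λ x y → trans (sumFin-cong k (λ i → homo (φ-additive i) x y)) (sumFin-distrib-+ k _ _) }

  ^-isAdditive-* : ∀ a b → IsAdditive (_^ a) → IsAdditive (_^ b) → IsAdditive (_^ (a ℕ.* b))
  ^-isAdditive-* a b ^a-additive ^b-additive = record
    { cong = ^-congˡ (a ℕ.* b)
    ; homo = λ x y → begin
        (x + y) ^ (a ℕ.* b)          ≈⟨ sym (^-assocʳ (x + y) a b) ⟩
        ((x + y) ^ a) ^ b            ≈⟨ ^-congˡ b (homo ^a-additive x y) ⟩
        (x ^ a + y ^ a) ^ b          ≈⟨ homo ^b-additive _ _ ⟩
        (x ^ a) ^ b + (y ^ a) ^ b    ≈⟨ +-cong (^-assocʳ x a b) (^-assocʳ y a b) ⟩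
        x ^ (a ℕ.* b) + y ^ (a ℕ.* b) ∎ }

  ^1-isAdditive : IsAdditive (_^ 1)
  ^1-isAdditive = record
    { cong = ^-congˡ 1
    ; homo = λ x y → trans (*-identityʳ _) (sym (+-cong (*-identityʳ x) (*-identityʳ y))) }

  ^ⁿ-isAdditive : ∀ {e} → IsAdditive (_^ e) → ∀ n → IsAdditive (_^ (e ℕ.^ n))
  ^ⁿ-isAdditive         ^e-additive zero    = ^1-isAdditive
  ^ⁿ-isAdditive {e = e} ^e-additive (suc n) = ^-isAdditive-* e (e ℕ.^ n) ^e-additive (^ⁿ-isAdditive ^e-additive n)

module Subfield {c ℓ : Level} (K : FiniteField c ℓ) {p r n : ℕ} (p-prime : Prime p)
                (size≡qⁿ : FiniteField.size K ≡ (p ℕ.^ r) ℕ.^ n) where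
  open FiniteField K
  open FieldOps K
  open FieldBasics K
  open AdditiveMaps K
  open Counting K using (characteristic; x^size≈x)
  open CharacteristicP K using (frobenius)
  open SetoidReasoning setoid

  q : ℕ
  q = p ℕ.^ r

  Fq : Carrier → Set ℓ
  Fq = InSub q

  T : Carrier → Carrier
  T = Tr q n

  instance
    p≢0 : ℕ.NonZero p
    p≢0 = prime⇒nonZero p-prime

  ^p-isAdditive : IsAdditive (_^ p)
  ^p-isAdditive = record
    { cong = ^-congˡ p
    ; homo = frobenius p-prime (characteristic p (r ℕ.* n) (≡.trans size≡qⁿ (ℕ.^-*-assoc p r n))) }

  ^q-isAdditive : IsAdditive (_^ q)
  ^q-isAdditive = ^ⁿ-isAdditive ^p-isAdditive r

  ^qⁱ-isAdditive : ∀ i → IsAdditive (_^ (q ℕ.^ i))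
  ^qⁱ-isAdditive = ^ⁿ-isAdditive ^q-isAdditive

  Fq-resp : ∀ {x y} → x ≈ y → Fq x → Fq y
  Fq-resp x≈y x∈Fq = trans (^-congˡ q (sym x≈y)) (trans x∈Fq x≈y)

  Fq-0 : Fq 0#
  Fq-0 = 0-homo ^q-isAdditive

  Fq-1 : Fq 1#
  Fq-1 = 1^n≈1 q

  Fq-+ : ∀ {x y} → Fq x → Fq y → Fq (x + y)
  Fq-+ x∈Fq y∈Fq = trans (homo ^q-isAdditive _ _) (+-cong x∈Fq y∈Fq)

  Fq-neg : ∀ {x} → Fq x → Fq (- x)
  Fq-neg x∈Fq = trans (-‿homo ^q-isAdditive _) (-‿cong x∈Fq)

  Fq-* : ∀ {x y} → Fq x → Fq y → Fq (x * y)
  Fq-* {x} {y} x∈Fq y∈Fq = trans (^-distrib-* x y q) (*-cong x∈Fq y∈Fq)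

  Fq-⁻¹ : ∀ {x} → ¬ (x ≈ 0#) → Fq x → Fq (x ⁻¹)
  Fq-⁻¹ {x} x≉0 x∈Fq = *-cancelˡ x≉0 (begin
    x * (x ⁻¹) ^ q         ≈⟨ *-congʳ (sym x∈Fq) ⟩
    x ^ q * (x ⁻¹) ^ q     ≈⟨ sym (^-distrib-* x (x ⁻¹) q) ⟩
    (x * x ⁻¹) ^ q         ≈⟨ ^-congˡ q (inverseʳ x x≉0) ⟩
    1# ^ q                 ≈⟨ 1^n≈1 q ⟩
    1#                     ≈⟨ sym (inverseʳ x x≉0) ⟩
    x * x ⁻¹               ∎)

  Fq-^ : ∀ {x} m → Fq x → Fq (x ^ m)
  Fq-^ zero    _    = Fq-1
  Fq-^ (suc m) x∈Fq = Fq-* x∈Fq (Fq-^ m x∈Fq)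

  Fq-sumFin : ∀ k {f : Fin k → Carrier} → (∀ i → Fq (f i)) → Fq (sumFin k f)
  Fq-sumFin zero    _      = Fq-0
  Fq-sumFin (suc k) f∈Fq = Fq-+ (f∈Fq F.zero) (Fq-sumFin k (λ i → f∈Fq (F.suc i)))

  Fq-evalPoly : ∀ {cs} → All Fq cs → ∀ {x} → Fq x → Fq (evalPoly cs x)
  Fq-evalPoly []          _    = Fq-0
  Fq-evalPoly (a∈Fq ∷ cs∈Fq) x∈Fq = Fq-+ a∈Fq (Fq-* x∈Fq (Fq-evalPoly cs∈Fq x∈Fq))

  Fq-^qⁱ : ∀ {x} → Fq x → ∀ i → x ^ (q ℕ.^ i) ≈ x
  Fq-^qⁱ {x} x∈Fq zero    = *-identityʳ x
  Fq-^qⁱ {x} x∈Fq (suc i) = begin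
    x ^ (q ℕ.* q ℕ.^ i)   ≈⟨ sym (^-assocʳ x q (q ℕ.^ i)) ⟩
    (x ^ q) ^ (q ℕ.^ i)   ≈⟨ ^-congˡ (q ℕ.^ i) x∈Fq ⟩
    x ^ (q ℕ.^ i)         ≈⟨ Fq-^qⁱ x∈Fq i ⟩
    x                     ∎

  T-isAdditive : IsAdditive T
  T-isAdditive = sumFin-isAdditive n (λ i → ^qⁱ-isAdditive (toℕ i))

  T-Fq-linear : ∀ {a} x → Fq a → T (a * x) ≈ a * T x
  T-Fq-linear {a} x a∈Fq = begin
    T (a * x)
      ≈⟨ sumFin-cong n (λ i → trans (^-distrib-* a x (q ℕ.^ toℕ i)) (*-congʳ (Fq-^qⁱ a∈Fq (toℕ i)))) ⟩
    sumFin n (λ i → a * x ^ (q ℕ.^ toℕ i))    ≈⟨ sym (*-distribˡ-sumFin n a _) ⟩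
    a * T x                                   ∎

  T∈Fq : ∀ x → Fq (T x)
  T∈Fq x = begin
    T x ^ q                                    ≈⟨ sumFin-homo ^q-isAdditive n _ ⟩
    sumFin n (λ i → (x ^ (q ℕ.^ toℕ i)) ^ q)   ≈⟨ sumFin-cong n (λ i → ^-comm x (q ℕ.^ toℕ i) q) ⟩
    sumFin n (λ i → (x ^ q) ^ (q ℕ.^ toℕ i))   ≈⟨ sumFin-cong n (λ i → ^-assocʳ x q (q ℕ.^ toℕ i)) ⟩
    sumFin n (λ i → x ^ (q ℕ.^ suc (toℕ i)))   ≈⟨ sumFin-rotate n (λ i → x ^ (q ℕ.^ i)) xq^n≈x ⟩
    T x                                        ∎
    where
    xq^n≈x : x ^ (q ℕ.^ n) ≈ x ^ 1
    xq^n≈x = begin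
      x ^ (q ℕ.^ n)   ≡⟨ ≡.cong (x ^_) (≡.sym size≡qⁿ) ⟩
      x ^ size        ≈⟨ x^size≈x x ⟩
      x               ≈⟨ sym (*-identityʳ x) ⟩
      x ^ 1           ∎

  1<q : r ℕ.≥ 1 → 1 ℕ.< q
  1<q r≥1 = ℕ.<-≤-trans (ℕ.nonTrivial⇒n>1 p ⦃ prime⇒nonTrivial p-prime ⦄)
                        (ℕ.≤-trans (ℕ.≤-reflexive (≡.sym (ℕ.*-identityʳ p))) (ℕ.^-monoʳ-≤ p r≥1))

  module _ (1<q : 1 ℕ.< q) where
    open MonicPolynomial K

    -- Tr q (1 + m) is monic of degree q ^ m, so it cannot vanish at q ^ m + 1 distinct points.
    Tr-nonzero : ∀ m → q ℕ.^ m ℕ.< size → ∃ λ x → ¬ (Tr q (suc m) x ≈ 0#)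
    Tr-nonzero m q^m<size = pts (proj₁ not-all-roots) , proj₂ not-all-roots
      where
      powers : Σ (Vec Carrier (q ℕ.^ m)) λ cs → ∀ x → evalPoly (V.toList cs) x ≈ sumFin m (λ i → x ^ (q ℕ.^ toℕ i))
      powers = ∑-powers-polynomial m (λ i → q ℕ.^ toℕ i) (q ℕ.^ m) (λ i → ℕ.^-monoʳ-< q 1<q (F.toℕ<n i))
      Tr≈evalMonic : ∀ x → Tr q (suc m) x ≈ evalMonic (proj₁ powers) x
      Tr≈evalMonic x = trans (sumFin-last m (λ i → x ^ (q ℕ.^ i))) (+-congʳ (sym (proj₂ powers x)))
      pts : Fin (suc (q ℕ.^ m)) → Carrier
      pts i = enum (F.inject≤ i q^m<size)
      pts-inj : ∀ i j → pts i ≈ pts j → i ≡ j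
      pts-inj i j eq = F.inject≤-injective q^m<size q^m<size i j (enum-inj _ _ eq)
      not-all-roots : ∃ λ i → ¬ (Tr q (suc m) (pts i) ≈ 0#)
      not-all-roots = F.¬∀⟶∃¬ _ (λ i → Tr q (suc m) (pts i) ≈ 0#) (λ i → Tr q (suc m) (pts i) ≟ 0#)
        (λ all-roots → monic-roots _ (proj₁ powers) pts pts-inj (λ i → trans (sym (Tr≈evalMonic (pts i))) (all-roots i)))

    T-surjective : n ℕ.≥ 1 → ∀ t → Fq t → ∃ λ x → T x ≈ t
    T-surjective n≥1 t t∈Fq = (t * T x₀ ⁻¹) * x₀ , (begin
      T ((t * T x₀ ⁻¹) * x₀)    ≈⟨ T-Fq-linear x₀ (Fq-* t∈Fq (Fq-⁻¹ Tx₀≉0 (T∈Fq x₀))) ⟩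
      (t * T x₀ ⁻¹) * T x₀      ≈⟨ *-assoc _ _ _ ⟩
      t * (T x₀ ⁻¹ * T x₀)      ≈⟨ *-congˡ (trans (*-comm _ _) (inverseʳ _ Tx₀≉0)) ⟩
      t * 1#                    ≈⟨ *-identityʳ t ⟩
      t                         ∎)
      where
      instance _ = ℕ.>-nonZero n≥1
      n≡1+n-1 : n ≡ suc (n ℕ.∸ 1)
      n≡1+n-1 = ≡.sym (ℕ.suc-pred n)
      q^[n-1]<size : q ℕ.^ (n ℕ.∸ 1) ℕ.< size
      q^[n-1]<size = ≡.subst (q ℕ.^ (n ℕ.∸ 1) ℕ.<_) (≡.trans (≡.cong (q ℕ.^_) (≡.sym n≡1+n-1)) (≡.sym size≡qⁿ))
                       (ℕ.^-monoʳ-< q 1<q (ℕ.n<1+n (n ℕ.∸ 1)))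
      T-nonzero : ∃ λ x → ¬ (T x ≈ 0#)
      T-nonzero = ≡.subst (λ k → ∃ λ x → ¬ (Tr q k x ≈ 0#)) (≡.sym n≡1+n-1) (Tr-nonzero (n ℕ.∸ 1) q^[n-1]<size)
      x₀ : Carrier
      x₀ = proj₁ T-nonzero
      Tx₀≉0 : ¬ (T x₀ ≈ 0#)
      Tx₀≉0 = proj₂ T-nonzero

  module Linearized (m : ℕ) (coef : Fin m → Carrier) (coef∈Fq : ∀ i → Fq (coef i)) where
    L : Carrier → Carrier
    L x = sumFin m (λ i → coef i * x ^ (p ℕ.^ toℕ i))

    A : Carrier → Carrier
    A x = sumFin m (λ i → coef i * x ^ (p ℕ.^ toℕ i ℕ.∸ 1))

    L-isAdditive : IsAdditive L
    L-isAdditive = sumFin-isAdditive m (λ i → scale-isAdditive (coef i) (^ⁿ-isAdditive ^p-isAdditive (toℕ i)))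

    A-cong : Congruent₁ _≈_ A
    A-cong x≈y = sumFin-cong m (λ i → *-congˡ (^-congˡ (p ℕ.^ toℕ i ℕ.∸ 1) x≈y))

    L≈x*A : ∀ x → L x ≈ x * A x
    L≈x*A x = trans (sumFin-cong m (λ i → coef*x^pⁱ (coef i) (toℕ i))) (sym (*-distribˡ-sumFin m x _))
      where
      coef*x^pⁱ : ∀ a k → a * x ^ (p ℕ.^ k) ≈ x * (a * x ^ (p ℕ.^ k ℕ.∸ 1))
      coef*x^pⁱ a k = trans (*-congˡ (x^n≈x*x^[n∸1] x (p ℕ.^ k) ⦃ ℕ.m^n≢0 p k ⦄))
        (solve 3 (λ a x y → a :* (x :* y) := x :* (a :* y)) refl a x _)

    A∈Fq : ∀ {x} → Fq x → Fq (A x)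
    A∈Fq x∈Fq = Fq-sumFin m (λ i → Fq-* (coef∈Fq i) (Fq-^ (p ℕ.^ toℕ i ℕ.∸ 1) x∈Fq))

    -- Both T and L are sums of Frobenius powers with coefficients in Fq, which commute.
    T∘L≈L∘T : ∀ x → T (L x) ≈ L (T x)
    T∘L≈L∘T x = begin
      T (L x)
        ≈⟨ sumFin-cong n (λ j → sumFin-homo (^qⁱ-isAdditive (toℕ j)) m _) ⟩
      sumFin n (λ j → sumFin m (λ i → (coef i * x ^ pⁱ i) ^ qʲ j))
        ≈⟨ sumFin-cong n (λ j → sumFin-cong m (λ i → coef-commutes i j)) ⟩
      sumFin n (λ j → sumFin m (λ i → coef i * (x ^ qʲ j) ^ pⁱ i))
        ≈⟨ sumFin-comm n m _ ⟩
      sumFin m (λ i → sumFin n (λ j → coef i * (x ^ qʲ j) ^ pⁱ i))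
        ≈⟨ sumFin-cong m (λ i → sym (*-distribˡ-sumFin n _ _)) ⟩
      sumFin m (λ i → coef i * sumFin n (λ j → (x ^ qʲ j) ^ pⁱ i))
        ≈⟨ sumFin-cong m (λ i → *-congˡ (sym (sumFin-homo (^ⁿ-isAdditive ^p-isAdditive (toℕ i)) n _))) ⟩
      L (T x)
        ∎
      where
      pⁱ : Fin m → ℕ
      pⁱ i = p ℕ.^ toℕ i
      qʲ : Fin n → ℕ
      qʲ j = q ℕ.^ toℕ j
      coef-commutes : ∀ i j → (coef i * x ^ pⁱ i) ^ qʲ j ≈ coef i * (x ^ qʲ j) ^ pⁱ i
      coef-commutes i j = trans (^-distrib-* (coef i) _ (qʲ j)) (*-cong (Fq-^qⁱ (coef∈Fq i) (toℕ j)) (^-comm x (pⁱ i) (qʲ j)))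

module FiberedPermutation {c ℓ : Level} (K : FiniteField c ℓ) where
  open FiniteField K
  open FieldOps K
  open SetoidReasoning setoid

  Permutes-cong : ∀ {f f′} → (∀ x → f x ≈ f′ x) → Permutes f ⇔ Permutes f′
  Permutes-cong f≈f′ = mk⇔ (transport f≈f′) (transport (λ x → sym (f≈f′ x)))
    where
    transport : ∀ {f f′} → (∀ x → f x ≈ f′ x) → Permutes f → Permutes f′
    transport f≈f′ (f-injective , f-surjective) =
      (λ x y f′x≈f′y → f-injective x y (trans (f≈f′ x) (trans f′x≈f′y (sym (f≈f′ y))))) ,
      (λ y → proj₁ (f-surjective y) , trans (sym (f≈f′ _)) (proj₂ (f-surjective y)))

  PermutesSubset-cong : ∀ {S f f′} → (∀ {x y} → x ≈ y → S x → S y) → (∀ x → f x ≈ f′ x) →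
                        PermutesSubset S f ⇔ PermutesSubset S f′
  PermutesSubset-cong {S} S-resp f≈f′ = mk⇔ (transport f≈f′) (transport (λ x → sym (f≈f′ x)))
    where
    transport : ∀ {f f′} → (∀ x → f x ≈ f′ x) → PermutesSubset S f → PermutesSubset S f′
    transport f≈f′ (f-maps , f-injective , f-surjective) =
      (λ x x∈S → S-resp (f≈f′ x) (f-maps x x∈S)) ,
      (λ x y x∈S y∈S f′x≈f′y → f-injective x y x∈S y∈S (trans (f≈f′ x) (trans f′x≈f′y (sym (f≈f′ y))))) ,
      (λ y y∈S → let (x , x∈S , fx≈y) = f-surjective y y∈S in x , x∈S , trans (sym (f≈f′ x)) fx≈y)

  -- The criterion of Akbary, Ghioca and Wang.
  module Criterion (S : Carrier → Set ℓ) (S-resp : ∀ {x y} → x ≈ y → S x → S y)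
           (τ : Carrier → Carrier) (τ-cong : Congruent₁ _≈_ τ) (τ∈S : ∀ x → S (τ x))
           (τ-surjective : ∀ t → S t → ∃ λ x → τ x ≈ t)
           (F g : Carrier → Carrier) (g-cong : Congruent₁ _≈_ g) (τ∘F≈g∘τ : ∀ x → τ (F x) ≈ g (τ x))
           (F-fiber-injective : ∀ x y → τ x ≈ τ y → F x ≈ F y → x ≈ y)
           (F-fiber-surjective : ∀ x w → τ w ≈ g (τ x) → ∃ λ y → τ y ≈ τ x × F y ≈ w) where

    permutesSubset⇒permutes : PermutesSubset S g → Permutes F
    permutesSubset⇒permutes (_ , g-injective , g-surjective) = F-injective , F-surjective
      where
      F-injective : ∀ x y → F x ≈ F y → x ≈ y
      F-injective x y Fx≈Fy = F-fiber-injective x y (g-injective (τ x) (τ y) (τ∈S x) (τ∈S y) (begin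
        g (τ x)    ≈⟨ sym (τ∘F≈g∘τ x) ⟩
        τ (F x)    ≈⟨ τ-cong Fx≈Fy ⟩
        τ (F y)    ≈⟨ τ∘F≈g∘τ y ⟩
        g (τ y)    ∎)) Fx≈Fy
      F-surjective : ∀ w → Σ Carrier λ y → F y ≈ w
      F-surjective w with g-surjective (τ w) (τ∈S w)
      ... | t , t∈S , gt≈τw with τ-surjective t t∈S
      ...   | x , τx≈t with F-fiber-surjective x w (trans (sym gt≈τw) (g-cong (sym τx≈t)))
      ...     | y , _ , Fy≈w = y , Fy≈w

    permutes⇒permutesSubset : Permutes F → PermutesSubset S g
    permutes⇒permutesSubset (F-injective , F-surjective) = g-maps , g-injective , g-surjective
      where
      g-maps : ∀ t → S t → S (g t)
      g-maps t t∈S with τ-surjective t t∈S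
      ... | x , τx≈t = S-resp (trans (τ∘F≈g∘τ x) (g-cong τx≈t)) (τ∈S (F x))
      g-injective : ∀ t₁ t₂ → S t₁ → S t₂ → g t₁ ≈ g t₂ → t₁ ≈ t₂
      g-injective t₁ t₂ t₁∈S t₂∈S gt₁≈gt₂ with τ-surjective t₁ t₁∈S | τ-surjective t₂ t₂∈S
      ... | x₁ , τx₁≈t₁ | x₂ , τx₂≈t₂ with F-fiber-surjective x₁ (F x₂) (begin
        τ (F x₂)   ≈⟨ τ∘F≈g∘τ x₂ ⟩
        g (τ x₂)   ≈⟨ g-cong τx₂≈t₂ ⟩
        g t₂       ≈⟨ sym gt₁≈gt₂ ⟩
        g t₁       ≈⟨ g-cong (sym τx₁≈t₁) ⟩
        g (τ x₁)   ∎)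
      ... | y , τy≈τx₁ , Fy≈Fx₂ = begin
        t₁         ≈⟨ sym τx₁≈t₁ ⟩
        τ x₁       ≈⟨ sym τy≈τx₁ ⟩
        τ y        ≈⟨ τ-cong (F-injective y x₂ Fy≈Fx₂) ⟩
        τ x₂       ≈⟨ τx₂≈t₂ ⟩
        t₂         ∎
      g-surjective : ∀ s → S s → Σ Carrier λ t → S t × g t ≈ s
      g-surjective s s∈S with τ-surjective s s∈S
      ... | x , τx≈s with F-surjective x
      ...   | z , Fz≈x = τ z , τ∈S z , trans (sym (τ∘F≈g∘τ z)) (trans (τ-cong Fz≈x) τx≈s)

    permutes⇔permutesSubset : Permutes F ⇔ PermutesSubset S g
    permutes⇔permutesSubset = mk⇔ permutes⇒permutesSubset permutesSubset⇒permutes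

module TracePermutation {c ℓ : Level} (K : FiniteField c ℓ) {p r n : ℕ} (p-prime : Prime p)
                        (size≡qⁿ : FiniteField.size K ≡ (p ℕ.^ r) ℕ.^ n) (r≥1 : r ℕ.≥ 1) (n≥1 : n ℕ.≥ 1)
                        (m : ℕ) (coef : Fin m → FiniteField.Carrier K)
                        (coef∈Fq : ∀ i → FieldOps.InSub K (p ℕ.^ r) (coef i))
                        (a : FiniteField.Carrier K) (a∈Fq : FieldOps.InSub K (p ℕ.^ r) a)
                        (a≉0 : ¬ (FiniteField._≈_ K a (FiniteField.0# K))) where
  open FiniteField K
  open FieldOps K
  open FieldBasics K
  open AdditiveMaps K
  open Subfield K {r = r} {n = n} p-prime size≡qⁿ
  open Linearized m coef coef∈Fq
  open SetoidReasoning setoid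

  aa⁻¹≈1 : a * a ⁻¹ ≈ 1#
  aa⁻¹≈1 = inverseʳ a a≉0

  module Fibration (k : Carrier → Carrier) (k-cong : Congruent₁ _≈_ k) (k∈Fq : ∀ {t} → Fq t → Fq (k t))
           (P-permutes : ∀ t → Fq t → PermutesSubset (λ x → T x ≈ 0#) (λ x → L x - ((k t * a ⁻¹ + A t) * x)))
           where

    P : Carrier → Carrier → Carrier
    P t x = L x - ((k t * a ⁻¹ + A t) * x)

    Φ : Carrier → Carrier → Carrier
    Φ t x = x * (k t + a * A t) - a * L x

    F : Carrier → Carrier
    F x = Φ (T x) x

    g : Carrier → Carrier
    g t = t * k t

    Φ-isAdditive : ∀ t → IsAdditive (Φ t)
    Φ-isAdditive t = record
      { cong = λ x≈y → +-cong (*-congʳ x≈y) (-‿cong (*-congˡ (cong L-isAdditive x≈y)))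
      ; homo = λ x y → trans (+-congˡ (-‿cong (*-congˡ (homo L-isAdditive x y))))
          (solve 6 (λ x y c a u v → (x :+ y) :* c :- a :* (u :+ v) := (x :* c :- a :* u) :+ (y :* c :- a :* v)) refl
            x y (k t + a * A t) a (L x) (L y)) }

    Φ-congˡ : ∀ {t t′} x → t ≈ t′ → Φ t x ≈ Φ t′ x
    Φ-congˡ x t≈t′ = +-congʳ (*-congˡ (+-cong (k-cong t≈t′) (*-congˡ (A-cong t≈t′))))

    Φ≈-a*P : ∀ t x → Φ t x ≈ - a * P t x
    Φ≈-a*P t x = begin
      x * (k t + a * A t) - a * L x                 ≈⟨ +-congʳ (*-congˡ (+-congʳ (sym (trans (*-congʳ aa⁻¹≈1) (*-identityˡ _))))) ⟩
      x * ((a * a ⁻¹) * k t + a * A t) - a * L x    ≈⟨ solve 6 (λ x a b kt At Lx → x :* ((a :* b) :* kt :+ a :* At) :- a :* Lx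
                                                          := (:- a) :* (Lx :- (kt :* b :+ At) :* x)) refl x a (a ⁻¹) (k t) (A t) (L x) ⟩
      - a * P t x                                   ∎

    T∘Φ≈g : ∀ t x → Fq t → T x ≈ t → T (Φ t x) ≈ g t
    T∘Φ≈g t x t∈Fq Tx≈t = begin
      T (x * C - a * L x)        ≈⟨ sub-homo T-isAdditive _ _ ⟩
      T (x * C) - T (a * L x)    ≈⟨ +-cong (trans (cong T-isAdditive (*-comm x C)) (T-Fq-linear x C∈Fq)) (-‿cong (T-Fq-linear (L x) a∈Fq)) ⟩
      C * T x - a * T (L x)      ≈⟨ +-cong (*-congˡ Tx≈t) (-‿cong (*-congˡ (T∘L≈L∘T x))) ⟩
      C * t - a * L (T x)        ≈⟨ +-congˡ (-‿cong (*-congˡ (trans (cong L-isAdditive Tx≈t) (L≈x*A t)))) ⟩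
      C * t - a * (t * A t)      ≈⟨ solve 4 (λ kt a At t → (kt :+ a :* At) :* t :- a :* (t :* At) := t :* kt) refl (k t) a (A t) t ⟩
      t * k t                    ∎
      where
      C : Carrier
      C = k t + a * A t
      C∈Fq : Fq C
      C∈Fq = Fq-+ (k∈Fq t∈Fq) (Fq-* a∈Fq (A∈Fq t∈Fq))

    Φ≈0⇒P≈0 : ∀ {t x} → Φ t x ≈ 0# → P t x ≈ 0#
    Φ≈0⇒P≈0 {t} {x} Φ≈0 = x*y≈0⇒y≈0 -a≉0 (trans (sym (Φ≈-a*P t x)) Φ≈0)
      where
      -a≉0 : ¬ (- a ≈ 0#)
      -a≉0 -a≈0 = a≉0 (trans (sym (-‿involutive a)) (trans (-‿cong -a≈0) -0#≈0#))

    F-fiber-injective : ∀ x₁ x₂ → T x₁ ≈ T x₂ → F x₁ ≈ F x₂ → x₁ ≈ x₂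
    F-fiber-injective x₁ x₂ Tx₁≈Tx₂ Fx₁≈Fx₂ =
      x-y≈0⇒x≈y (P-injective (x₁ - x₂) 0# T[x₁-x₂]≈0 (0-homo T-isAdditive)
        (trans (Φ≈0⇒P≈0 Φ[x₁-x₂]≈0) (sym (Φ≈0⇒P≈0 (0-homo (Φ-isAdditive t))))))
      where
      t : Carrier
      t = T x₁
      P-injective : ∀ y₁ y₂ → T y₁ ≈ 0# → T y₂ ≈ 0# → P t y₁ ≈ P t y₂ → y₁ ≈ y₂
      P-injective = proj₁ (proj₂ (P-permutes t (T∈Fq x₁)))
      T[x₁-x₂]≈0 : T (x₁ - x₂) ≈ 0#
      T[x₁-x₂]≈0 = trans (sub-homo T-isAdditive x₁ x₂) (trans (+-congˡ (-‿cong (sym Tx₁≈Tx₂))) (-‿inverseʳ t))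
      Φ[x₁-x₂]≈0 : Φ t (x₁ - x₂) ≈ 0#
      Φ[x₁-x₂]≈0 = begin
        Φ t (x₁ - x₂)          ≈⟨ sub-homo (Φ-isAdditive t) x₁ x₂ ⟩
        F x₁ - Φ t x₂          ≈⟨ +-congˡ (-‿cong (Φ-congˡ x₂ Tx₁≈Tx₂)) ⟩
        F x₁ - F x₂            ≈⟨ +-congʳ Fx₁≈Fx₂ ⟩
        F x₂ - F x₂            ≈⟨ -‿inverseʳ _ ⟩
        0#                     ∎

    F-fiber-surjective : ∀ x w → T w ≈ g (T x) → ∃ λ y → T y ≈ T x × F y ≈ w
    F-fiber-surjective x w Tw≈g[Tx] = x + y , T[x+y]≈Tx , (begin
      Φ (T (x + y)) (x + y)         ≈⟨ Φ-congˡ (x + y) T[x+y]≈Tx ⟩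
      Φ t (x + y)                   ≈⟨ homo (Φ-isAdditive t) x y ⟩
      F x + Φ t y                   ≈⟨ +-congˡ (trans (Φ≈-a*P t y) (*-congˡ Py≈v)) ⟩
      F x + - a * (- a ⁻¹ * z)      ≈⟨ solve 4 (λ f a b z → f :+ (:- a) :* ((:- b) :* z) := f :+ (a :* b) :* z) refl (F x) a (a ⁻¹) z ⟩
      F x + (a * a ⁻¹) * z          ≈⟨ +-congˡ (trans (*-congʳ aa⁻¹≈1) (*-identityˡ z)) ⟩
      F x + (w - F x)               ≈⟨ solve 2 (λ f w → f :+ (w :- f) := w) refl (F x) w ⟩
      w                             ∎)
      where
      t : Carrier
      t = T x
      z : Carrier
      z = w - F x
      Tz≈0 : T z ≈ 0#
      Tz≈0 = trans (sub-homo T-isAdditive w (F x))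
               (trans (+-cong Tw≈g[Tx] (-‿cong (T∘Φ≈g t x (T∈Fq x) refl))) (-‿inverseʳ _))
      v : Carrier
      v = - a ⁻¹ * z
      Tv≈0 : T v ≈ 0#
      Tv≈0 = trans (T-Fq-linear z (Fq-neg (Fq-⁻¹ a≉0 a∈Fq))) (trans (*-congˡ Tz≈0) (zeroʳ _))
      preimage : Σ Carrier λ y → T y ≈ 0# × P t y ≈ v
      preimage = proj₂ (proj₂ (P-permutes t (T∈Fq x))) v Tv≈0
      y : Carrier
      y = proj₁ preimage
      Py≈v : P t y ≈ v
      Py≈v = proj₂ (proj₂ preimage)
      T[x+y]≈Tx : T (x + y) ≈ t
      T[x+y]≈Tx = trans (homo T-isAdditive x y) (trans (+-congˡ (proj₁ (proj₂ preimage))) (+-identityʳ t))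

    open FiberedPermutation.Criterion K Fq Fq-resp T (cong T-isAdditive) T∈Fq (T-surjective (1<q r≥1) n≥1)
             F g (λ t≈t′ → *-cong t≈t′ (k-cong t≈t′)) (λ x → T∘Φ≈g (T x) x (T∈Fq x) refl)
             F-fiber-injective F-fiber-surjective
      public using (permutes⇔permutesSubset)

theorem3 : {c ℓ : Level} (p r n : ℕ) → Prime p → r ≥ 1 → n ≥ 1 →
  (K : FiniteField c ℓ) →
  let open FiniteField K
      open FieldOps K
      q = p ^ℕ r
      Fq = InSub q
      T = Tr q n
      KerTr = λ x → T x ≈ 0#
  in FiniteField.size K ≡ q ^ℕ n →
     (h : List Carrier) → All Fq h →
     (coef : Fin (r *ℕ n) → Carrier) → (∀ i → Fq (coef i)) →
     let L = λ x → sumFin (r *ℕ n) (λ i → coef i * (x ^ (p ^ℕ toℕ i)))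
         A = λ x → sumFin (r *ℕ n) (λ i → coef i * (x ^ ((p ^ℕ toℕ i) ∸ 1)))
         hh = evalPoly h
     in (a : Carrier) → Fq a → ¬ (a ≈ 0#) →
        (∀ b → Fq b →
           PermutesSubset KerTr (λ x → L x - ((hh b * (a ⁻¹) + A b) * x)) ×
           PermutesSubset KerTr (λ x → L x - (((hh b + 1#) * (a ⁻¹) + A b) * x))) →
        let H = λ x → (hh (T x) + (a * A (T x))) - (a * A x)
        in IsCPP (λ x → x * H x) ⇔ IsCPPSub Fq (λ x → x * hh x)
theorem3 p r n p-prime r≥1 n≥1 K size≡qⁿ h h∈Fq coef coef∈Fq a a∈Fq a≉0 P-permutes =
  xH-permutes⇔ ×-⇔ xH+x-permutes⇔
  where
  open FiniteField K
  open FieldOps K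
  open FieldBasics K using (solve; _:=_; _:+_; _:*_; _:-_; evalPoly-cong)
  open FiberedPermutation K using (Permutes-cong; PermutesSubset-cong)
  open Subfield K {r = r} {n = n} p-prime size≡qⁿ using (T; Fq; Fq-resp; Fq-evalPoly; Fq-+; Fq-1)
  open Subfield.Linearized K {r = r} {n = n} p-prime size≡qⁿ (r *ℕ n) coef coef∈Fq using (A; L; L≈x*A)
  hh : Carrier → Carrier
  hh = evalPoly h
  module Fib₁ = TracePermutation.Fibration K p-prime size≡qⁿ r≥1 n≥1 (r *ℕ n) coef coef∈Fq a a∈Fq a≉0
                  hh (evalPoly-cong h) (Fq-evalPoly h∈Fq) (λ t t∈Fq → proj₁ (P-permutes t t∈Fq))
  module Fib₂ = TracePermutation.Fibration K p-prime size≡qⁿ r≥1 n≥1 (r *ℕ n) coef coef∈Fq a a∈Fq a≉0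
                  (λ t → hh t + 1#) (λ t≈t′ → +-congʳ (evalPoly-cong h t≈t′))
                  (λ t∈Fq → Fq-+ (Fq-evalPoly h∈Fq t∈Fq) Fq-1)
                  (λ t t∈Fq → proj₂ (P-permutes t t∈Fq))
  H : Carrier → Carrier
  H x = (hh (T x) + a * A (T x)) - a * A x
  xH≈F₁ : ∀ x → x * H x ≈ Fib₁.F x
  xH≈F₁ x = trans (solve 4 (λ x c a u → x :* (c :- a :* u) := x :* c :- a :* (x :* u)) refl x _ a (A x))
                  (+-congˡ (-‿cong (*-congˡ (sym (L≈x*A x)))))
  xH+x≈F₂ : ∀ x → x * H x + x ≈ Fib₂.F x
  xH+x≈F₂ x = trans (+-congˡ (sym (*-identityʳ x)))
    (trans (solve 6 (λ x h o a B u → x :* ((h :+ a :* B) :- a :* u) :+ x :* o := x :* ((h :+ o) :+ a :* B) :- a :* (x :* u))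
              refl x (hh (T x)) 1# a (A (T x)) (A x))
           (+-congˡ (-‿cong (*-congˡ (sym (L≈x*A x))))))
  g₂≈xh+x : ∀ t → Fib₂.g t ≈ t * hh t + t
  g₂≈xh+x t = trans (distribˡ t _ _) (+-congˡ (*-identityʳ t))
  xH-permutes⇔ : Permutes (λ x → x * H x) ⇔ PermutesSubset Fq (λ t → t * hh t)
  xH-permutes⇔ = Fib₁.permutes⇔permutesSubset ⇔-∘ Permutes-cong xH≈F₁
  xH+x-permutes⇔ : Permutes (λ x → x * H x + x) ⇔ PermutesSubset Fq (λ t → t * hh t + t)
  xH+x-permutes⇔ = PermutesSubset-cong Fq-resp g₂≈xh+x ⇔-∘ (Fib₂.permutes⇔permutesSubset ⇔-∘ Permutes-cong xH+x≈F₂)
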